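{- For any positive integer $k$ and any graph $G$, if $G$ has a Grundy coloring using at least $k$ colors, then $G$ has a $k$-Grundy witness.
   Context: The $k$-Grundy tree $(T_k,\ell_k)$, with $\ell_k:V(T_k)\to[k]$, is defined recursively: $T_1$ is a single vertex $r_1$ (its root) with $\ell_1(r_1)=1$; for $k\ge2$, take pairwise vertex-disjoint copies of the $z$-Grundy trees $(T_z,\ell_z)$ with roots $r_z$ for $z\in[k-1]$, add a new root $r_k$ adjacent to each $r_z$ ($z\in[k-1]$), set $\ell_k(r_k)=k$ and let $\ell_k$ agree with $\ell_z$ on $V(T_z)$. A $k$-Grundy witness for $G$ is a function $\omega:V(T_k)\to V(G)$ such that (1) for each $z\in[k]$, $\{\omega(t):\ell_k(t)=z\}$ is an independent set in $G$; (2) for $t,t'\in V(T_k)$ with $\ell_k(t)\ne\ell_k(t')$, $\omega(t)\ne\omega(t')$; (3) for every edge $tt'$ of $T_k$, $\omega(t)\omega(t')\in E(G)$. A Grundy coloring of $G$ using $k'$ colors is a proper coloring $c:V(G)\to[k']$ with every color used such that every vertex $v$ with $c(v)=t$ has, for every $s\in[t-1]$, a neighbor of color $s$; "at least $k$ colors" means for some $k'\ge k$. -}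

module Defs where

open import Data.Nat using (ℕ; zero; suc; _≤_; _<_; pred)
open import Data.Fin using (Fin; toℕ)
open import Data.Product using (Σ; _×_; ∃; ∃-syntax)
open import Data.Sum using (_⊎_)
open import Relation.Nullary using (¬_)
open import Relation.Binary.PropositionalEquality using (_≡_; _≢_)

record Graph : Set₁ where
  field
    n     : ℕ
    Adj   : Fin n → Fin n → Set
    sym   : ∀ {u v} → Adj u v → Adj v u
    irrefl : ∀ {v} → ¬ Adj v v
open Graph public

-- Vertices of the Grundy tree T_(suc m).  'root' is r_(suc m);
-- 'sub z t' is the vertex t of the attached copy of T_(suc (toℕ z)),
-- for z ∈ Fin m, i.e. for the copies T_1, …, T_m.
data TNode : ℕ → Set where
  root : ∀ {m} → TNode m
  sub  : ∀ {m} (z : Fin m) → TNode (toℕ z) → TNode m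

label : ∀ {m} → TNode m → ℕ
label {m} root = suc m
label (sub z t) = label t

data Child : ∀ {m} → TNode m → TNode m → Set where
  top  : ∀ {m} (z : Fin m) → Child {m} root (sub z root)
  lift : ∀ {m} (z : Fin m) {t t' : TNode (toℕ z)} →
         Child t t' → Child {m} (sub z t) (sub z t')

TEdge : ∀ {m} → TNode m → TNode m → Set
TEdge t t' = Child t t' ⊎ Child t' t

-- The k-Grundy tree, k ≥ 1, has vertex set TNode (pred k).
-- k-Grundy witness for G.
record GrundyWitness (G : Graph) (k : ℕ) : Set where
  field
    ω     : TNode (pred k) → Fin (n G)
    indep : ∀ t t' → label t ≡ label t' → ¬ Adj G (ω t) (ω t')
    dist  : ∀ t t' → label t ≢ label t' → ω t ≢ ω t'
    edge  : ∀ t t' → TEdge t t' → Adj G (ω t) (ω t')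

record IsGrundyColoring (G : Graph) (k' : ℕ) (c : Fin (n G) → ℕ) : Set where
  field
    range  : ∀ v → 1 ≤ c v × c v ≤ k'
    proper : ∀ u v → Adj G u v → c u ≢ c v
    onto   : ∀ s → 1 ≤ s → s ≤ k' → ∃[ v ] c v ≡ s
    grundy : ∀ v s → 1 ≤ s → s < c v → ∃[ u ] (Adj G v u × c u ≡ s)

HasGrundyColoringAtLeast : Graph → ℕ → Set
HasGrundyColoringAtLeast G k =
  ∃[ k' ] (k ≤ k' × ∃[ c ] IsGrundyColoring G k' c)

-- A vertex v of colour k in a Grundy colouring has neighbours of every colour
-- s < k, each of which again has neighbours of every smaller colour, and so on.
-- Unfolding this recursively maps T_k into G so that the colour of the image of
-- every tree vertex is its label and tree edges go to graph edges; since the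
-- colouring is proper, such a map is a k-Grundy witness.
module Submission where

open import Defs
open import Data.Nat using (ℕ; suc; _≤_; _<_; s≤s; z≤n)
open import Data.Fin using (Fin; toℕ)
open import Data.Fin.Properties using (toℕ<n)
open import Data.Product using (_×_; _,_; proj₁; proj₂; ∃-syntax)
open import Data.Sum using (inj₁; inj₂)
open import Relation.Binary.PropositionalEquality
  using (_≡_; _≢_; trans; cong; subst)
  renaming (sym to ≡-sym)

HasSmallerColouredNeighbours : (G : Graph) → (Fin (n G) → ℕ) → Set
HasSmallerColouredNeighbours G c =
  ∀ v s → 1 ≤ s → s < c v → ∃[ u ] (Adj G v u × c u ≡ s)

module _ (G : Graph) (c : Fin (n G) → ℕ) where

  record LabelPreservingTreeMap (m : ℕ) : Set where
    field
      ω      : TNode m → Fin (n G)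
      colour : ∀ t → c (ω t) ≡ label t
      child  : ∀ {t t'} → Child t t' → Adj G (ω t) (ω t')

  open LabelPreservingTreeMap

  labelPreservingTreeMap⇒witness : ∀ {m} →
    (∀ u v → Adj G u v → c u ≢ c v) →
    LabelPreservingTreeMap m → GrundyWitness G (suc m)
  labelPreservingTreeMap⇒witness proper f = record
    { ω     = ω f
    ; indep = λ t t' ℓ≡ adj →
        proper _ _ adj (trans (colour f t) (trans ℓ≡ (≡-sym (colour f t'))))
    ; dist  = λ t t' ℓ≢ ω≡ →
        ℓ≢ (trans (≡-sym (colour f t)) (trans (cong c ω≡) (colour f t')))
    ; edge  = λ where
        t t' (inj₁ t→t') → child f t→t'
        t t' (inj₂ t'→t) → Graph.sym G (child f t'→t)
    }

  module _ (smaller : HasSmallerColouredNeighbours G c) where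

    neighbourOfColour : ∀ {m} v → c v ≡ suc m → (z : Fin m) →
                        ∃[ u ] (Adj G v u × c u ≡ suc (toℕ z))
    neighbourOfColour v cv≡ z =
      smaller v (suc (toℕ z)) (s≤s z≤n)
        (subst (suc (toℕ z) <_) (≡-sym cv≡) (s≤s (toℕ<n z)))

    unfold : ∀ m v → c v ≡ suc m → LabelPreservingTreeMap m
    ω (unfold m v cv≡) root = v
    ω (unfold m v cv≡) (sub z t) with neighbourOfColour v cv≡ z
    ... | u , _ , cu≡ = ω (unfold (toℕ z) u cu≡) t
    colour (unfold m v cv≡) root = cv≡
    colour (unfold m v cv≡) (sub z t) with neighbourOfColour v cv≡ z
    ... | u , _ , cu≡ = colour (unfold (toℕ z) u cu≡) t
    child (unfold m v cv≡) (top z) with neighbourOfColour v cv≡ z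
    ... | u , v~u , _ = v~u
    child (unfold m v cv≡) (lift z t→t') with neighbourOfColour v cv≡ z
    ... | u , _ , cu≡ = child (unfold (toℕ z) u cu≡) t→t'

lemma29 : (k : ℕ) → 1 ≤ k → (G : Graph) →
          HasGrundyColoringAtLeast G k → GrundyWitness G k
lemma29 (suc m) _ G (k' , k≤k' , c , grundyColouring) =
  labelPreservingTreeMap⇒witness G c proper (unfold G c grundy m v cv≡)
  where
    open IsGrundyColoring grundyColouring
    v : Fin (n G)
    v = proj₁ (onto (suc m) (s≤s z≤n) k≤k')
    cv≡ : c v ≡ suc m
    cv≡ = proj₂ (onto (suc m) (s≤s z≤n) k≤k')
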